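{- Let $m$ be an even positive integer and $n$ an integer with $m<n/2$, and let $G=C(n;1,m)$. For every vertex $i$ and every integer $\ell > m/2$, $$|N_\ell[i]| \le 2\left\lfloor \tfrac m2\right\rfloor^2 + 2\ell m - 2\left\lfloor \tfrac m2\right\rfloor m + 2\left\lfloor\tfrac m2\right\rfloor + 1.$$
   Context: For an integer $n$ and positive integers $s_1<\dots<s_t\le n/2$, the circulant graph $C(n;s_1,\dots,s_t)$ has vertex set $\mathbb Z_n$, with distinct vertices $x,y$ adjacent iff $x-y \equiv \pm s_i \pmod n$ for some $i$. $N_\ell[x]=\{y: d(x,y)\le \ell\}$ is the $\ell$-th closed neighbourhood of $x$. -}

module Defs where

open import Data.Nat using (ℕ; zero; suc; _+_; _%_; NonZero)
open import Data.Fin using (Fin; toℕ)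
open import Data.Fin.Subset using (Subset; _∈_)
open import Data.Product using (_×_)
open import Data.Sum using (_⊎_)
open import Relation.Binary.PropositionalEquality using (_≡_)
open import Relation.Nullary using (¬_)

DiffMod : (n : ℕ) → .{{_ : NonZero n}} → Fin n → Fin n → ℕ → Set
DiffMod n x y s = (toℕ y + s) % n ≡ toℕ x

Adj : (n : ℕ) → .{{_ : NonZero n}} → (s₁ s₂ : ℕ) → Fin n → Fin n → Set
Adj n s₁ s₂ x y =
  ¬ (x ≡ y) ×
  ((DiffMod n x y s₁ ⊎ DiffMod n y x s₁) ⊎ (DiffMod n x y s₂ ⊎ DiffMod n y x s₂))

-- Within n s₁ s₂ k x y : there is a walk from x to y of length at most k,
-- i.e. d(x, y) ≤ k in C(n; s₁, s₂).
data Within (n : ℕ) .{{_ : NonZero n}} (s₁ s₂ : ℕ) : ℕ → Fin n → Fin n → Set where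
  here : ∀ {k x} → Within n s₁ s₂ k x x
  step : ∀ {k x y z} → Adj n s₁ s₂ x y → Within n s₁ s₂ k y z →
         Within n s₁ s₂ (suc k) x z

InBall : (n : ℕ) → .{{_ : NonZero n}} → (s₁ s₂ ℓ : ℕ) → Fin n → Fin n → Set
InBall n s₁ s₂ ℓ x y = Within n s₁ s₂ ℓ x y

-- C(n; s₁, s₂) is the quotient by nℤ of the Cayley graph of ℤ with generators ±s₁, ±s₂. Hence a
-- walk of length at most ℓ from i ends at i + a + b m (mod n) with |a| + |b| ≤ ℓ, and |N_ℓ[i]| is
-- at most the number of integers of the form a + b m. For any h, those with |b| ≤ ℓ - h lie in
-- [-R, R] with R = ℓ + (ℓ - h)(m - 1); the others have |b| = ℓ - t for some t < h and lie within
-- distance t of ±(ℓ - t) m. That is 2R + 1 + 2h² integers in all, and h = m/2 gives the bound.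
module Submission where

open import Data.Nat as ℕ using (ℕ; zero; suc; _∸_; _/_; _≤_; _<_; z≤n; s≤s; NonZero)
import Data.Nat.Properties as ℕₚ
import Data.Nat.DivMod as ℕD
import Data.Nat.Tactic.RingSolver as ℕSolver
open import Data.Integer using (ℤ; +_; +0; +[1+_]; -[1+_]; -_; 0ℤ; 1ℤ)
import Data.Integer.Properties as ℤₚ
open import Data.Integer.DivMod using (_%ℕ_; _/ℕ_; n%ℕd<d; a≡a%ℕn+[a/ℕn]*n)
open import Data.Fin using (Fin; zero; suc; toℕ; fromℕ<)
open import Data.Fin.Properties using (toℕ<n; toℕ-fromℕ<; toℕ-injective)
open import Data.Fin.Subset using (Subset; inside; outside; ⊥; ⁅_⁆; _∪_; _∈_)
open import Data.Fin.Subset.Properties using (∣⊥∣≡0; ∣p∣≤∣x∷p∣; ∪-identityˡ; x∈⁅x⁆; x∈p∪q⁺; p⊆q⇒∣p∣≤∣q∣)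
open import Data.List using (List; []; _∷_; _++_; map; foldr; upTo; length)
open import Data.List.Properties using (length-map; length-++; length-upTo)
open import Data.List.Membership.Propositional using () renaming (_∈_ to _∈ˡ_)
open import Data.List.Membership.Propositional.Properties using (∈-map⁺; ∈-++⁺ˡ; ∈-++⁺ʳ; ∈-upTo⁺)
open import Data.List.Relation.Unary.Any using (here; there)
open import Data.Product using (∃₂; ∃-syntax; _×_; _,_)
open import Data.Sum using (_⊎_; inj₁; inj₂)
open import Data.Vec using (_∷_)
open import Relation.Binary.PropositionalEquality
open import Relation.Nullary using (yes; no)
open import Data.Empty using (⊥-elim)

open import Algebra.Properties.CommutativeSemigroup ℕₚ.+-commutativeSemigroup using (interchange)

open import Defs

∸-<-swap : ∀ ℓ h {b} → ℓ ∸ h < b → b ≤ ℓ → ℓ ∸ b < h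
∸-<-swap ℓ zero ℓ<b b≤ℓ = ⊥-elim (ℕₚ.<⇒≱ ℓ<b b≤ℓ)
∸-<-swap ℓ h@(suc _) {b} ℓ∸h<b _ = ℕₚ.m<n+o⇒m∸n<o ℓ b (begin-strict
  ℓ               ≤⟨ ℕₚ.m≤n+m∸n ℓ h ⟩
  h ℕ.+ (ℓ ∸ h)   <⟨ ℕₚ.+-monoʳ-< h ℓ∸h<b ⟩
  h ℕ.+ b         ≡⟨ ℕₚ.+-comm h b ⟩
  b ℕ.+ h         ∎)
  where open ℕₚ.≤-Reasoning

module _ where
  open import Data.Integer using (_+_; _*_; _-_; ∣_∣)
  open import Data.Integer.Tactic.RingSolver using (solve-∀)

  infix 4 _≡_mod_
  record _≡_mod_ (a b : ℤ) (n : ℕ) : Set where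
    constructor congruent
    field
      quotient : ℤ
      equation : a ≡ b + quotient * + n

  ≡⇒≡mod : ∀ {a b n} → a ≡ b → a ≡ b mod n
  ≡⇒≡mod {b = b} refl = congruent 0ℤ (sym (ℤₚ.+-identityʳ b))

  ≡mod-sym : ∀ {a b n} → a ≡ b mod n → b ≡ a mod n
  ≡mod-sym {a} {b} {n} (congruent q a≡b+qn) = congruent (- q) (begin
    b                           ≡⟨ cancel b q (+ n) ⟩
    b + q * + n + - q * + n     ≡⟨ cong (_+ - q * + n) a≡b+qn ⟨
    a + - q * + n               ∎)
    where
    open ≡-Reasoning
    cancel : ∀ b q n → b ≡ b + q * n + - q * n
    cancel = solve-∀

  ≡mod-trans : ∀ {a b c n} → a ≡ b mod n → b ≡ c mod n → a ≡ c mod n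
  ≡mod-trans {a} {b} {c} {n} (congruent p a≡b+pn) (congruent q b≡c+qn) = congruent (q + p) (begin
    a                           ≡⟨ a≡b+pn ⟩
    b + p * + n                 ≡⟨ cong (_+ p * + n) b≡c+qn ⟩
    c + q * + n + p * + n       ≡⟨ regroup c q p (+ n) ⟩
    c + (q + p) * + n           ∎)
    where
    open ≡-Reasoning
    regroup : ∀ c q p n → c + q * n + p * n ≡ c + (q + p) * n
    regroup = solve-∀

  ≡mod-+ʳ : ∀ {a b n} c → a ≡ b mod n → a + c ≡ b + c mod n
  ≡mod-+ʳ {a} {b} {n} c (congruent q a≡b+qn) = congruent q (begin
    a + c                       ≡⟨ cong (_+ c) a≡b+qn ⟩
    b + q * + n + c             ≡⟨ swap b (q * + n) c ⟩
    b + c + q * + n             ∎)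
    where
    open ≡-Reasoning
    swap : ∀ b x c → b + x + c ≡ b + c + x
    swap = solve-∀

  ≡+mod⇒≡-mod : ∀ {a b n} s → a ≡ b + s mod n → b ≡ a - s mod n
  ≡+mod⇒≡-mod {a} {b} s a≡b+s =
    ≡mod-trans (≡⇒≡mod (cancel b s)) (≡mod-+ʳ (- s) (≡mod-sym a≡b+s))
    where
    cancel : ∀ b s → b ≡ b + s - s
    cancel = solve-∀

  no-wraparound : ∀ {n} (x y : Fin n) j → + toℕ x ≢ + toℕ y + + suc j * + n
  no-wraparound {n} x y j x≡y+[1+j]n = ℕₚ.<⇒≱ (toℕ<n x) (begin
    n                         ≤⟨ ℕₚ.m≤m+n n (j ℕ.* n) ⟩
    suc j ℕ.* n               ≤⟨ ℕₚ.m≤n+m _ (toℕ y) ⟩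
    toℕ y ℕ.+ suc j ℕ.* n     ≡⟨ ℤₚ.+-injective y+[1+j]n≡x ⟩
    toℕ x                     ∎)
    where
    open ℕₚ.≤-Reasoning
    y+[1+j]n≡x : + (toℕ y ℕ.+ suc j ℕ.* n) ≡ + toℕ x
    y+[1+j]n≡x = trans (ℤₚ.pos-+ (toℕ y) _)
      (trans (cong (λ z → + toℕ y + z) (ℤₚ.pos-* (suc j) n)) (sym x≡y+[1+j]n))

  toℕ-≡mod⇒≡ : ∀ {n} {x y : Fin n} → + toℕ x ≡ + toℕ y mod n → x ≡ y
  toℕ-≡mod⇒≡ (congruent +0 x≡y+0) =
    toℕ-injective (ℤₚ.+-injective (trans x≡y+0 (ℤₚ.+-identityʳ _)))
  toℕ-≡mod⇒≡ {x = x} {y} (congruent +[1+ j ] x≡y+qn) = ⊥-elim (no-wraparound x y j x≡y+qn)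
  toℕ-≡mod⇒≡ {n} {x} {y} (congruent -[1+ j ] x≡y+qn) =
    ⊥-elim (no-wraparound y x j (_≡_mod_.equation (≡mod-sym {n = n} (congruent -[1+ j ] x≡y+qn))))

  infixl 6 _⊕_
  _⊕_ : ∀ {n} .{{_ : NonZero n}} → Fin n → ℤ → Fin n
  _⊕_ {n} x c = fromℕ< (n%ℕd<d (+ toℕ x + c) n)

  ⊕-≡mod : ∀ {n} .{{_ : NonZero n}} (x : Fin n) c → + toℕ (x ⊕ c) ≡ + toℕ x + c mod n
  ⊕-≡mod {n} x c = ≡mod-sym (congruent q (begin
    + toℕ x + c                 ≡⟨ a≡a%ℕn+[a/ℕn]*n (+ toℕ x + c) n ⟩
    + r + q * + n               ≡⟨ cong (λ k → + k + q * + n) (toℕ-fromℕ< (n%ℕd<d (+ toℕ x + c) n)) ⟨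
    + toℕ (x ⊕ c) + q * + n     ∎))
    where
    open ≡-Reasoning
    q = (+ toℕ x + c) /ℕ n
    r = (+ toℕ x + c) %ℕ n

  diffMod⇒≡mod : ∀ {n} .{{_ : NonZero n}} {x y : Fin n} {s} →
                   DiffMod n x y s → + toℕ x ≡ + toℕ y + + s mod n
  diffMod⇒≡mod {n} {x} {y} {s} y+s%n≡x = ≡mod-sym (congruent (+ q) (begin
    + toℕ y + + s                          ≡⟨ ℤₚ.pos-+ (toℕ y) s ⟨
    + (toℕ y ℕ.+ s)                        ≡⟨ cong +_ (ℕD.m≡m%n+[m/n]*n (toℕ y ℕ.+ s) n) ⟩
    + ((toℕ y ℕ.+ s) ℕ.% n ℕ.+ q ℕ.* n)   ≡⟨ cong (λ r → + (r ℕ.+ q ℕ.* n)) y+s%n≡x ⟩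
    + (toℕ x ℕ.+ q ℕ.* n)                  ≡⟨ ℤₚ.pos-+ (toℕ x) (q ℕ.* n) ⟩
    + toℕ x + + (q ℕ.* n)                  ≡⟨ cong (λ z → + toℕ x + z) (ℤₚ.pos-* q n) ⟩
    + toℕ x + + q * + n                    ∎))
    where
    open ≡-Reasoning
    q = (toℕ y ℕ.+ s) ℕ./ n

  InℤBall : (s₁ s₂ k : ℕ) → ℤ → Set
  InℤBall s₁ s₂ k c = ∃₂ λ a b → ∣ a ∣ ℕ.+ ∣ b ∣ ≤ k × c ≡ a * + s₁ + b * + s₂

  inℤBall-0 : ∀ {s₁ s₂} k → InℤBall s₁ s₂ k 0ℤ
  inℤBall-0 k = 0ℤ , 0ℤ , z≤n , refl

  inℤBall-s₁ : ∀ {s₁ s₂} → InℤBall s₁ s₂ 1 (+ s₁)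
  inℤBall-s₁ {s₁} = 1ℤ , 0ℤ , ℕₚ.≤-refl ,
    sym (trans (ℤₚ.+-identityʳ _) (ℤₚ.*-identityˡ (+ s₁)))

  inℤBall-s₂ : ∀ {s₁ s₂} → InℤBall s₁ s₂ 1 (+ s₂)
  inℤBall-s₂ {s₂ = s₂} = 0ℤ , 1ℤ , ℕₚ.≤-refl ,
    sym (trans (ℤₚ.+-identityˡ _) (ℤₚ.*-identityˡ (+ s₂)))

  inℤBall-neg : ∀ {s₁ s₂ k c} → InℤBall s₁ s₂ k c → InℤBall s₁ s₂ k (- c)
  inℤBall-neg {s₁} {s₂} {k} (a , b , ∣a∣+∣b∣≤k , refl) =
    - a , - b ,
    subst (_≤ k) (sym (cong₂ ℕ._+_ (ℤₚ.∣-i∣≡∣i∣ a) (ℤₚ.∣-i∣≡∣i∣ b))) ∣a∣+∣b∣≤k ,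
    negate a b (+ s₁) (+ s₂)
    where
    negate : ∀ a b s₁ s₂ → - (a * s₁ + b * s₂) ≡ - a * s₁ + - b * s₂
    negate = solve-∀

  inℤBall-+ : ∀ {s₁ s₂ j k c d} → InℤBall s₁ s₂ j c → InℤBall s₁ s₂ k d →
              InℤBall s₁ s₂ (j ℕ.+ k) (c + d)
  inℤBall-+ {s₁} {s₂} {j} {k} (a , b , ab≤j , refl) (a′ , b′ , ab′≤k , refl) =
    a + a′ , b + b′ , bound , regroup a b a′ b′ (+ s₁) (+ s₂)
    where
    open ℕₚ.≤-Reasoning
    bound : ∣ a + a′ ∣ ℕ.+ ∣ b + b′ ∣ ≤ j ℕ.+ k
    bound = begin
      ∣ a + a′ ∣ ℕ.+ ∣ b + b′ ∣                  ≤⟨ ℕₚ.+-mono-≤ (ℤₚ.∣i+j∣≤∣i∣+∣j∣ a a′) (ℤₚ.∣i+j∣≤∣i∣+∣j∣ b b′) ⟩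
      (∣ a ∣ ℕ.+ ∣ a′ ∣) ℕ.+ (∣ b ∣ ℕ.+ ∣ b′ ∣)  ≡⟨ interchange (∣ a ∣) (∣ a′ ∣) (∣ b ∣) (∣ b′ ∣) ⟩
      (∣ a ∣ ℕ.+ ∣ b ∣) ℕ.+ (∣ a′ ∣ ℕ.+ ∣ b′ ∣)  ≤⟨ ℕₚ.+-mono-≤ ab≤j ab′≤k ⟩
      j ℕ.+ k                                    ∎
    regroup : ∀ a b a′ b′ s₁ s₂ → a * s₁ + b * s₂ + (a′ * s₁ + b′ * s₂) ≡ (a + a′) * s₁ + (b + b′) * s₂
    regroup = solve-∀

  adj-lift : ∀ {n} .{{_ : NonZero n}} {s₁ s₂} {x y : Fin n} → Adj n s₁ s₂ x y →
             ∃[ c ] InℤBall s₁ s₂ 1 c × + toℕ y ≡ + toℕ x + c mod n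
  adj-lift {s₁ = s₁} {x = x} {y} (_ , inj₁ (inj₁ x≡y+s₁)) =
    - + s₁ , inℤBall-neg inℤBall-s₁ , ≡+mod⇒≡-mod (+ s₁) (diffMod⇒≡mod {x = x} {y} x≡y+s₁)
  adj-lift {s₁ = s₁} {x = x} {y} (_ , inj₁ (inj₂ y≡x+s₁)) =
    + s₁ , inℤBall-s₁ , diffMod⇒≡mod {x = y} {x} y≡x+s₁
  adj-lift {s₂ = s₂} {x = x} {y} (_ , inj₂ (inj₁ x≡y+s₂)) =
    - + s₂ , inℤBall-neg inℤBall-s₂ , ≡+mod⇒≡-mod (+ s₂) (diffMod⇒≡mod {x = x} {y} x≡y+s₂)
  adj-lift {s₂ = s₂} {x = x} {y} (_ , inj₂ (inj₂ y≡x+s₂)) =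
    + s₂ , inℤBall-s₂ , diffMod⇒≡mod {x = y} {x} y≡x+s₂

  within-lift : ∀ {n} .{{_ : NonZero n}} {s₁ s₂ k} {x y : Fin n} → Within n s₁ s₂ k x y →
                ∃[ c ] InℤBall s₁ s₂ k c × + toℕ y ≡ + toℕ x + c mod n
  within-lift {k = k} {x} here = 0ℤ , inℤBall-0 k , ≡⇒≡mod (sym (ℤₚ.+-identityʳ (+ toℕ x)))
  within-lift {x = x} (step x~y y⇝z) with adj-lift x~y | within-lift y⇝z
  ... | c , c∈B₁ , y≡x+c | d , d∈Bₖ , z≡y+d =
    c + d , inℤBall-+ c∈B₁ d∈Bₖ ,
    ≡mod-trans z≡y+d (≡mod-trans (≡mod-+ʳ d y≡x+c) (≡⇒≡mod (ℤₚ.+-assoc (+ toℕ x) c d)))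

  centred : ℕ → List ℤ
  centred r = map (λ k → + k - + r) (upTo (suc (2 ℕ.* r)))

  length-centred : ∀ r → length (centred r) ≡ suc (2 ℕ.* r)
  length-centred r = trans (length-map _ (upTo (suc (2 ℕ.* r)))) (length-upTo _)

  ∈-centred : ∀ {r} d → ∣ d ∣ ≤ r → d ∈ˡ centred r
  ∈-centred {r} (+ k) k≤r =
    subst (_∈ˡ centred r) (trans (cong (_- + r) (ℤₚ.pos-+ r k)) (cancel (+ r) (+ k)))
      (∈-map⁺ _ (∈-upTo⁺ (s≤s (ℕₚ.+-monoʳ-≤ r (ℕₚ.m≤n⇒m≤n+o 0 k≤r)))))
    where
    cancel : ∀ r k → r + k - r ≡ k
    cancel = solve-∀
  ∈-centred {r} -[1+ k ] 1+k≤r with ℕₚ.m≤n⇒∃[o]m+o≡n 1+k≤r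
  ... | t , refl =
    subst (_∈ˡ centred r) (trans (cong (λ z → + t - z) (ℤₚ.pos-+ (suc k) t)) (cancel (+ suc k) (+ t)))
      (∈-map⁺ _ (∈-upTo⁺ (s≤s (ℕₚ.m≤n⇒m≤n+o _ (ℕₚ.m≤n+m t (suc k))))))
    where
    cancel : ∀ s t → t - (s + t) ≡ - s
    cancel = solve-∀

  interval : ℤ → ℕ → List ℤ
  interval c r = map (_+_ c) (centred r)

  length-interval : ∀ c r → length (interval c r) ≡ suc (2 ℕ.* r)
  length-interval c r = trans (length-map _ (centred r)) (length-centred r)

  ∈-interval : ∀ c {r} d → ∣ d ∣ ≤ r → c + d ∈ˡ interval c r
  ∈-interval c d d≤r = ∈-map⁺ (_+_ c) (∈-centred d d≤r)

  ∣i∣≡u⇒i≡±u : ∀ b {u} → ∣ b ∣ ≡ u → b ≡ + u ⊎ b ≡ - + u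
  ∣i∣≡u⇒i≡±u (+ k) refl = inj₁ refl
  ∣i∣≡u⇒i≡±u -[1+ k ] refl = inj₂ refl

  module _ (ℓ m : ℕ) where

    sideIntervals : ℕ → List ℤ
    sideIntervals zero = []
    sideIntervals (suc t) =
      interval (+ (ℓ ∸ t) * + m) t ++ interval (- + (ℓ ∸ t) * + m) t ++ sideIntervals t

    length-sideIntervals : ∀ h → length (sideIntervals h) ≡ 2 ℕ.* (h ℕ.* h)
    length-sideIntervals zero = refl
    length-sideIntervals (suc t) = begin
      length (interval c₊ t ++ interval c₋ t ++ sideIntervals t)
        ≡⟨ length-++ (interval c₊ t) ⟩
      length (interval c₊ t) ℕ.+ length (interval c₋ t ++ sideIntervals t)
        ≡⟨ cong (length (interval c₊ t) ℕ.+_) (length-++ (interval c₋ t)) ⟩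
      length (interval c₊ t) ℕ.+ (length (interval c₋ t) ℕ.+ length (sideIntervals t))
        ≡⟨ cong₂ ℕ._+_ (length-interval c₊ t) (cong₂ ℕ._+_ (length-interval c₋ t) (length-sideIntervals t)) ⟩
      suc (2 ℕ.* t) ℕ.+ (suc (2 ℕ.* t) ℕ.+ 2 ℕ.* (t ℕ.* t))
        ≡⟨ square t ⟩
      2 ℕ.* (suc t ℕ.* suc t) ∎
      where
      open ≡-Reasoning
      c₊ = + (ℓ ∸ t) * + m
      c₋ = - + (ℓ ∸ t) * + m
      square : ∀ t → suc (2 ℕ.* t) ℕ.+ (suc (2 ℕ.* t) ℕ.+ 2 ℕ.* (t ℕ.* t)) ≡ 2 ℕ.* (suc t ℕ.* suc t)
      square = ℕSolver.solve-∀

    ∈-sideIntervals : ∀ {h t} b d → t < h → ∣ b ∣ ≡ ℓ ∸ t → ∣ d ∣ ≤ t → b * + m + d ∈ˡ sideIntervals h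
    ∈-sideIntervals {suc h} {t} b d (s≤s t≤h) ∣b∣≡ℓ-t d≤t with ℕₚ.m≤n⇒m<n∨m≡n t≤h
    ... | inj₁ t<h = ∈-++⁺ʳ (interval (+ (ℓ ∸ h) * + m) h)
      (∈-++⁺ʳ (interval (- + (ℓ ∸ h) * + m) h) (∈-sideIntervals b d t<h ∣b∣≡ℓ-t d≤t))
    ... | inj₂ refl with ∣i∣≡u⇒i≡±u b ∣b∣≡ℓ-t
    ...   | inj₁ refl = ∈-++⁺ˡ (∈-interval (+ (ℓ ∸ t) * + m) d d≤t)
    ...   | inj₂ refl = ∈-++⁺ʳ (interval (+ (ℓ ∸ t) * + m) t) (∈-++⁺ˡ (∈-interval (- + (ℓ ∸ t) * + m) d d≤t))

    radius : ℕ → ℕ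
    radius h = ℓ ℕ.+ (ℓ ∸ h) ℕ.* (m ∸ 1)

    ballCover : ℕ → List ℤ
    ballCover h = centred (radius h) ++ sideIntervals h

    length-ballCover : ∀ h → length (ballCover h) ≡ suc (2 ℕ.* radius h) ℕ.+ 2 ℕ.* (h ℕ.* h)
    length-ballCover h =
      trans (length-++ (centred (radius h))) (cong₂ ℕ._+_ (length-centred (radius h)) (length-sideIntervals h))

    ∣a+bm∣≤radius : ∀ h a b → ∣ a ∣ ℕ.+ ∣ b ∣ ≤ ℓ → ∣ b ∣ ≤ ℓ ∸ h → ∣ a + b * + m ∣ ≤ radius h
    ∣a+bm∣≤radius h a b ∣a∣+∣b∣≤ℓ ∣b∣≤ℓ-h = begin
      ∣ a + b * + m ∣                            ≤⟨ ℤₚ.∣i+j∣≤∣i∣+∣j∣ a (b * + m) ⟩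
      ∣ a ∣ ℕ.+ ∣ b * + m ∣                      ≡⟨ cong (∣ a ∣ ℕ.+_) (ℤₚ.abs-* b (+ m)) ⟩
      ∣ a ∣ ℕ.+ ∣ b ∣ ℕ.* m                      ≤⟨ ℕₚ.+-monoʳ-≤ ∣ a ∣ (ℕₚ.*-monoʳ-≤ ∣ b ∣ (ℕₚ.m≤n+m∸n m 1)) ⟩
      ∣ a ∣ ℕ.+ ∣ b ∣ ℕ.* suc (m ∸ 1)            ≡⟨ cong (∣ a ∣ ℕ.+_) (ℕₚ.*-suc ∣ b ∣ (m ∸ 1)) ⟩
      ∣ a ∣ ℕ.+ (∣ b ∣ ℕ.+ ∣ b ∣ ℕ.* (m ∸ 1))    ≡⟨ ℕₚ.+-assoc ∣ a ∣ ∣ b ∣ _ ⟨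
      ∣ a ∣ ℕ.+ ∣ b ∣ ℕ.+ ∣ b ∣ ℕ.* (m ∸ 1)      ≤⟨ ℕₚ.+-mono-≤ ∣a∣+∣b∣≤ℓ (ℕₚ.*-monoˡ-≤ (m ∸ 1) ∣b∣≤ℓ-h) ⟩
      radius h                                   ∎
      where open ℕₚ.≤-Reasoning

    ∈-ballCover : ∀ h {c} → InℤBall 1 m ℓ c → c ∈ˡ ballCover h
    ∈-ballCover h (a , b , ∣a∣+∣b∣≤ℓ , refl) with ∣ b ∣ ℕₚ.≤? ℓ ∸ h
    ... | yes ∣b∣≤ℓ-h =
      ∈-++⁺ˡ (subst (_∈ˡ centred (radius h)) (cong (_+ b * + m) (sym (ℤₚ.*-identityʳ a)))
                    (∈-centred _ (∣a+bm∣≤radius h a b ∣a∣+∣b∣≤ℓ ∣b∣≤ℓ-h)))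
    ... | no ∣b∣≰ℓ-h =
      ∈-++⁺ʳ (centred (radius h)) (subst (_∈ˡ sideIntervals h) reorder
        (∈-sideIntervals b a (∸-<-swap ℓ h (ℕₚ.≰⇒> ∣b∣≰ℓ-h) ∣b∣≤ℓ) (sym (ℕₚ.m∸[m∸n]≡n ∣b∣≤ℓ))
          (ℕₚ.m+n≤o⇒m≤o∸n ∣ a ∣ ∣a∣+∣b∣≤ℓ)))
      where
      ∣b∣≤ℓ = ℕₚ.m+n≤o⇒n≤o ∣ a ∣ ∣a∣+∣b∣≤ℓ
      reorder : b * + m + a ≡ a * 1ℤ + b * + m
      reorder = trans (ℤₚ.+-comm (b * + m) a) (cong (_+ b * + m) (sym (ℤₚ.*-identityʳ a)))

within⇒∈-cover : ∀ {n} .{{_ : NonZero n}} {m ℓ} h {x y : Fin n} →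
                 Within n 1 m ℓ x y → y ∈ˡ map (x ⊕_) (ballCover ℓ m h)
within⇒∈-cover {m = m} {ℓ} h {x} x⇝y with within-lift x⇝y
... | c , c∈B , y≡x+c =
  subst (_∈ˡ map (x ⊕_) (ballCover ℓ m h))
    (toℕ-≡mod⇒≡ (≡mod-trans (⊕-≡mod x c) (≡mod-sym y≡x+c)))
    (∈-map⁺ (x ⊕_) (∈-ballCover ℓ m h c∈B))

open import Data.Nat using (_+_; _*_)
open import Data.Nat.Divisibility using (_∣_; divides)
open import Data.Fin.Subset using (∣_∣)

∣⁅x⁆∪p∣≤1+∣p∣ : ∀ {n} (x : Fin n) (p : Subset n) → ∣ ⁅ x ⁆ ∪ p ∣ ≤ suc ∣ p ∣
∣⁅x⁆∪p∣≤1+∣p∣ zero    (b ∷ p) rewrite ∪-identityˡ p = s≤s (∣p∣≤∣x∷p∣ b p)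
∣⁅x⁆∪p∣≤1+∣p∣ (suc x) (inside ∷ p)  = s≤s (∣⁅x⁆∪p∣≤1+∣p∣ x p)
∣⁅x⁆∪p∣≤1+∣p∣ (suc x) (outside ∷ p) = ∣⁅x⁆∪p∣≤1+∣p∣ x p

fromList : ∀ {n} → List (Fin n) → Subset n
fromList = foldr (λ x p → ⁅ x ⁆ ∪ p) ⊥

∣fromList∣≤length : ∀ {n} (xs : List (Fin n)) → ∣ fromList xs ∣ ≤ length xs
∣fromList∣≤length {n} []   = ℕₚ.≤-reflexive (∣⊥∣≡0 n)
∣fromList∣≤length (x ∷ xs) = ℕₚ.≤-trans (∣⁅x⁆∪p∣≤1+∣p∣ x (fromList xs)) (s≤s (∣fromList∣≤length xs))

∈-fromList : ∀ {n} {x : Fin n} {xs} → x ∈ˡ xs → x ∈ fromList xs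
∈-fromList (here refl)  = x∈p∪q⁺ (inj₁ (x∈⁅x⁆ _))
∈-fromList (there x∈xs) = x∈p∪q⁺ (inj₂ (∈-fromList x∈xs))

∣p∣≤length : ∀ {n} {p : Subset n} xs → (∀ y → y ∈ p → y ∈ˡ xs) → ∣ p ∣ ≤ length xs
∣p∣≤length xs p⊆xs = ℕₚ.≤-trans (p⊆q⇒∣p∣≤∣q∣ (λ {y} y∈p → ∈-fromList (p⊆xs y y∈p))) (∣fromList∣≤length xs)

neighbourhood-size≤ : ∀ {n} .{{_ : NonZero n}} m ℓ h (i : Fin n) (S : Subset n) →
             (∀ y → y ∈ S → InBall n 1 m ℓ i y) → ∣ S ∣ ≤ suc (2 * radius ℓ m h) + 2 * (h * h)
neighbourhood-size≤ m ℓ h i S S⊆N[i] = begin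
  ∣ S ∣                                  ≤⟨ ∣p∣≤length _ (λ y y∈S → within⇒∈-cover h (S⊆N[i] y y∈S)) ⟩
  length (map (i ⊕_) (ballCover ℓ m h))  ≡⟨ length-map (i ⊕_) (ballCover ℓ m h) ⟩
  length (ballCover ℓ m h)               ≡⟨ length-ballCover ℓ m h ⟩
  suc (2 * radius ℓ m h) + 2 * (h * h)   ∎
  where open ℕₚ.≤-Reasoning

cover-length-at-half : ∀ q d → let h = suc q; m = h * 2; ℓ = h + d in
  suc (2 * radius ℓ m h) + 2 * (h * h) + 2 * h * m ≡ 2 * h * h + 2 * ℓ * m + 2 * h + 1
cover-length-at-half q d rewrite ℕₚ.m+n∸m≡n (suc q) d = identity q d
  where
  identity : ∀ q d → let h = suc q; m = h * 2; ℓ = h + d in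
    suc (2 * (ℓ + d * suc (q * 2))) + 2 * (h * h) + 2 * h * m ≡ 2 * h * h + 2 * ℓ * m + 2 * h + 1
  identity = ℕSolver.solve-∀

mainTheorem6 : (m n : ℕ) → .{{_ : NonZero n}} →
    0 < m → 2 ∣ m → 2 * m < n →
    (i : Fin n) → (ℓ : ℕ) → m / 2 < ℓ →
    (S : Subset n) → (∀ y → y ∈ S → InBall n 1 m ℓ i y) →
    ∣ S ∣ ≤ 2 * (m / 2) * (m / 2) + 2 * ℓ * m + 2 * (m / 2) + 1 ∸ 2 * (m / 2) * m
mainTheorem6 .(0 * 2) n () (divides zero refl) _ i ℓ _ S _
mainTheorem6 .(h * 2) n _ (divides h@(suc q) refl) _ i ℓ h/2<ℓ S S⊆N[i]
  rewrite ℕD.m*n/n≡m h 2 ⦃ _ ⦄ with ℕₚ.m≤n⇒∃[o]m+o≡n (ℕₚ.<⇒≤ h/2<ℓ)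
... | d , refl = ℕₚ.m+n≤o⇒m≤o∸n ∣ S ∣ (begin
  ∣ S ∣ + 2 * h * (h * 2)
    ≤⟨ ℕₚ.+-monoˡ-≤ (2 * h * (h * 2)) (neighbourhood-size≤ (h * 2) (h + d) h i S S⊆N[i]) ⟩
  suc (2 * radius (h + d) (h * 2) h) + 2 * (h * h) + 2 * h * (h * 2)
    ≡⟨ cover-length-at-half q d ⟩
  2 * h * h + 2 * (h + d) * (h * 2) + 2 * h + 1
    ∎)
  where open ℕₚ.≤-Reasoning
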